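{- In any quantitative strong masking game $\mathcal{Q}_{A^M,A'}$, both the refuter $R$ and the verifier $V$ have memoryless optimal strategies, i.e. there are memoryless $\pi_R^*,\pi_V^*$ with $\inf_{\pi_V}f_m(out(\pi_R^*,\pi_V))=\mathrm{val}(\mathcal{Q}_{A^M,A'})=\sup_{\pi_R}f_m(out(\pi_R,\pi_V^*))$.
   Context: Transition systems $\langle S,\Sigma,E,s_0\rangle$: finite $S$, finite alphabet, $E\subseteq S\times\Sigma\times S$, initial $s_0$, every state has an outgoing transition. $A=\langle S,\Sigma,E,s_0\rangle$ nominal, $A'=\langle S',\Sigma\cup\mathcal{F},E',s_0'\rangle$ implementation with fault labels $\mathcal{F}$ disjoint from $\Sigma$; $A^M$ adds a self-loop labelled by a fresh label $M$ at each state of $A$. Strong masking game graph (refuter $R$, verifier $V$): refuter nodes $(s,\#,s',R)$ and error node $s_{err}$; verifier nodes $(s,\sigma^k,s',V)$, $k\in\{1,2\}$; initial node $(s_0,\#,s_0',R)$. Edges: $(s,\#,s',R)\xrightarrow{\sigma}(t,\sigma^1,s',V)$ if $\sigma\in\Sigma$, $s\xrightarrow{\sigma}t$ in $A$; $(s,\#,s',R)\xrightarrow{\sigma}(s,\sigma^2,t',V)$ if $\sigma\in\Sigma\cup\mathcal{F}$, $s'\xrightarrow{\sigma}t'$ in $A'$; $(s,\sigma^2,s',V)\xrightarrow{\sigma}(t,\#,s',R)$ if $\sigma\in\Sigma$, $s\xrightarrow{\sigma}t$ in $A$; $(s,\sigma^1,s',V)\xrightarrow{\sigma}(s,\#,t',R)$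 if $\sigma\in\Sigma$, $s'\xrightarrow{\sigma}t'$ in $A'$; $(s,F^2,s',V)\xrightarrow{M}(t,\#,s',R)$ if $F\in\mathcal{F}$, $s\xrightarrow{M}t$ in $A^M$; nodes without outgoing edges get edges to $s_{err}$, which has self-loops. $\mathcal{Q}_{A^M,A'}$ weights edge $n\xrightarrow{e}n'$ by $(\chi_{\mathcal{F}}(e),\chi_{s_{err}}(n'))$; for a play with edge weights $(a_i,b_i)$, $f_m(\rho)=\lim_{n\to\infty}\frac{b_n}{1+\sum_{i=0}^n a_i}$; $\mathrm{val}(\mathcal{Q}_{A^M,A'})=\sup_{\pi_R}\inf_{\pi_V}f_m(out(\pi_R,\pi_V))=\inf_{\pi_V}\sup_{\pi_R}f_m(out(\pi_R,\pi_V))$. A strategy maps finite play prefixes ending in the player's node to an outgoing edge; it is memoryless if it depends only on the last node. -}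

module Defs where

open import Data.Nat as ℕ using (ℕ; zero; suc)
open import Data.Fin using (Fin; _≟_)
open import Data.Bool using (Bool; true; false)
open import Data.Unit using (⊤; tt)
open import Data.Sum using (_⊎_; inj₁; inj₂)
open import Data.Product using (Σ; _×_; _,_; proj₁; proj₂; ∃-syntax)
open import Data.List using (List; []; _∷_)
open import Data.Integer using (+_)
open import Data.Rational using (ℚ; _/_; _-_; ∣_∣; _<_; _≤_; 0ℚ)
open import Relation.Nullary using (¬_)
open import Relation.Nullary.Decidable using (⌊_⌋)
open import Relation.Binary.PropositionalEquality using (_≡_)

record TS (S : Set) (L : Set) : Set where
  field
    E     : S → L → S → Bool
    s₀    : S
    total : ∀ s → ∃[ l ] ∃[ t ] (E s l t ≡ true)

-- A^M : adds a self-loop labelled by the fresh label M (= inj₂ tt) at each state.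
_ᴹ : ∀ {n k} → TS (Fin n) (Fin k) → TS (Fin n) (Fin k ⊎ ⊤)
_ᴹ {n} {k} A = record { E = EM ; s₀ = TS.s₀ A ; total = tot }
  where
  EM : Fin n → Fin k ⊎ ⊤ → Fin n → Bool
  EM s (inj₁ σ) t = TS.E A s σ t
  EM s (inj₂ _) t = ⌊ s ≟ t ⌋
  tot : ∀ s → ∃[ l ] ∃[ t ] (EM s l t ≡ true)
  tot s with TS.total A s
  ... | σ , t , p = inj₁ σ , t , p

data Player : Set where
  R V : Player

-- Strong masking game for nominal A (states Fin n, alphabet Σ = Fin k)
-- and implementation A' (states Fin n', labels Σ ⊎ 𝓕 with 𝓕 = Fin f).
module MaskingGame {n n' k f : ℕ}
                   (A : TS (Fin n) (Fin k))
                   (A' : TS (Fin n') (Fin k ⊎ Fin f)) where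

  private
    E  = TS.E A
    E' = TS.E A'
    EM = TS.E (A ᴹ)

  -- Game nodes: (s,#,s',R), (s,σ¹,s',V), (s,σ²,s',V), s_err
  data Node : Set where
    rN  : Fin n → Fin n' → Node
    v1N : Fin n → Fin k → Fin n' → Node
    v2N : Fin n → Fin k ⊎ Fin f → Fin n' → Node
    err : Node

  -- Edge labels: symbols of Σ, faults of 𝓕, the masking label M,
  -- and the label τ of edges into s_err (not a fault).
  data GLabel : Set where
    sym   : Fin k → GLabel
    fault : Fin f → GLabel
    M     : GLabel
    τ     : GLabel

  lab : Fin k ⊎ Fin f → GLabel
  lab (inj₁ σ) = sym σ
  lab (inj₂ F) = fault F

  data StdEdge : Node → GLabel → Node → Set where
    rA  : ∀ {s t s' σ} → E s σ t ≡ true →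
          StdEdge (rN s s') (sym σ) (v1N t σ s')
    rA' : ∀ {s s' t' l} → E' s' l t' ≡ true →
          StdEdge (rN s s') (lab l) (v2N s l t')
    vA  : ∀ {s t s' σ} → E s σ t ≡ true →
          StdEdge (v2N s (inj₁ σ) s') (sym σ) (rN t s')
    vA' : ∀ {s s' t' σ} → E' s' (inj₁ σ) t' ≡ true →
          StdEdge (v1N s σ s') (sym σ) (rN s t')
    vM  : ∀ {s t s' F} → EM s (inj₂ tt) t ≡ true →
          StdEdge (v2N s (inj₂ F) s') M (rN t s')

  data Edge : Node → GLabel → Node → Set where
    std   : ∀ {x e y} → StdEdge x e y → Edge x e y
    toErr : ∀ {x} → (∀ e y → ¬ StdEdge x e y) → Edge x τ err

  initNode : Node
  initNode = rN (TS.s₀ A) (TS.s₀ A')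

  -- s_err has a single (forced) edge; we assign it to R arbitrarily.
  owner : Node → Player
  owner (rN _ _)     = R
  owner (v1N _ _ _)  = V
  owner (v2N _ _ _)  = V
  owner err          = R

  Move : Node → Set
  Move x = Σ GLabel λ e → Σ Node λ y → Edge x e y

  -- The prefix is given as the list of
  -- previously visited nodes (most recent first) together with the last
  -- node x; the edge labels of a prefix are determined by its nodes.
  Strategy : Player → Set
  Strategy P = (past : List Node) (x : Node) → owner x ≡ P → Move x

  Memoryless : ∀ {P} → Strategy P → Set
  Memoryless π = ∀ past past' x p → π past x p ≡ π past' x p

  module _ (πR : Strategy R) (πV : Strategy V) where
    move : List Node → (x : Node) → Move x
    move past x with owner x in eq
    ... | R = πR past x eq
    ... | V = πV past x eq

    cfg : ℕ → List Node × Node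
    cfg zero = [] , initNode
    cfg (suc i) with cfg i
    ... | past , x = (x ∷ past) , proj₁ (proj₂ (move past x))

    edgeLabel : ℕ → GLabel
    edgeLabel i = proj₁ (move (proj₁ (cfg i)) (proj₂ (cfg i)))

    edgeTarget : ℕ → Node
    edgeTarget i = proj₁ (proj₂ (move (proj₁ (cfg i)) (proj₂ (cfg i))))

  χF : GLabel → ℕ
  χF (fault _) = 1
  χF _         = 0

  χerr : Node → ℕ
  χerr err = 1
  χerr _   = 0

  sumUpTo : (ℕ → ℕ) → ℕ → ℕ
  sumUpTo a zero    = a zero
  sumUpTo a (suc m) = sumUpTo a m ℕ.+ a (suc m)

  ratio : Strategy R → Strategy V → ℕ → ℚ
  ratio πR πV m =
    (+ χerr (edgeTarget πR πV m)) / suc (sumUpTo (λ i → χF (edgeLabel πR πV i)) m)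

  IsLimit : (ℕ → ℚ) → ℚ → Set
  IsLimit u q = ∀ ε → 0ℚ < ε → ∃[ N ] (∀ m → N ℕ.≤ m → ∣ u m - q ∣ < ε)

  fmIs : Strategy R → Strategy V → ℚ → Set
  fmIs πR πV q = IsLimit (ratio πR πV) q

  IsSup : (ℚ → Set) → ℚ → Set
  IsSup S v = (∀ q → S q → q ≤ v) × (∀ w → (∀ q → S q → q ≤ w) → v ≤ w)

  IsInf : (ℚ → Set) → ℚ → Set
  IsInf S v = (∀ q → S q → v ≤ q) × (∀ w → (∀ q → S q → w ≤ q) → w ≤ v)

  InfOverV : Strategy R → ℚ → Set
  InfOverV πR v = IsInf (λ q → ∃[ πV ] fmIs πR πV q) v

  SupOverR : Strategy V → ℚ → Set
  SupOverR πV v = IsSup (λ q → ∃[ πR ] fmIs πR πV q) v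

  IsVal : ℚ → Set
  IsVal v = IsSup (λ u → ∃[ πR ] InfOverV πR u) v
          × IsInf (λ u → ∃[ πV ] SupOverR πV u) v

-- The payoff of a play is 1/(1 + number of faults) if it reaches s_err and 0
-- otherwise, so only the least number of faults with which R can force s_err
-- matters.  Value iteration from (s_err ↦ 0, elsewhere ∞) with the Bellman
-- operator (minimum over R's edges, maximum over V's edges, of fault cost plus
-- successor cost) is pointwise antitone in ℕ ∪ {∞} on finitely many nodes, so it
-- reaches a fixed point D.  Against V choosing an edge that maximises D, each step
-- lowers D by at most the faults it commits; R forces s_err with at most D s₀
-- faults by playing at x the optimal edge of the round that first settled D x,
-- which makes (D, that round) decrease lexicographically.  Both strategies are
-- memoryless and val = 1/(1 + D s₀), or 0 when D s₀ = ∞.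
module Submission where

open import Defs
open import Data.Nat using (ℕ)
open import Data.Fin using (Fin)
open import Data.Sum using (_⊎_)
open import Data.Product using (_×_; ∃-syntax)
open import Data.Rational using (ℚ)

open import Data.Integer as ℤ using (+_; -[1+_])
import Data.Integer.Properties as ℤ
open import Data.Rational using (mkℚ; _/_; 0ℚ)
import Data.Rational as ℚ
import Data.Rational.Properties as ℚ
open import Data.Rational.Unnormalised using (mkℚᵘ)
import Data.Rational.Unnormalised as ℚᵘ
import Data.Rational.Unnormalised.Properties as ℚᵘ
open import Algebra.Properties.AbelianGroup ℚ.+-0-abelianGroup using (⁻¹-anti-homo‿-)

open import Data.Nat as ℕ using (zero; suc; _+_; _≤_; _<_; z≤n; s≤s; _≤′_; ≤′-refl; ≤′-step)
import Data.Nat.Properties as ℕ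
open import Data.Nat.Induction using (<-wellFounded)
open import Data.Product using (_,_; proj₁; proj₂)
open import Data.Product.Relation.Binary.Lex.Strict using (×-Lex; ×-wellFounded; ×-transitive)
open import Data.Sum using (inj₁; inj₂)
import Data.Sum as Sum
open import Data.Empty using (⊥-elim)
open import Data.Bool using (Bool; true; false)
open import Data.Unit using (tt)
open import Data.List using (List; []; _∷_; _++_; map; concatMap; allFin)
open import Data.List.Relation.Unary.Any as Any using (Any; here; there)
open import Data.List.Membership.Propositional using (_∈_; lose)
open import Data.List.Membership.Propositional.Properties using (∈-++⁺ˡ; ∈-++⁺ʳ; ∈-map⁺; ∈-concatMap⁺; ∈-allFin)
open import Data.List.Relation.Unary.All as All using (All; []; _∷_)
open import Function using (_∘_; case_of_)
open import Induction.WellFounded using (WellFounded; Acc; acc)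
open import Relation.Binary.Bundles using (TotalOrder)
open import Relation.Binary.PropositionalEquality hiding (J)
open import Relation.Nullary using (¬_; Dec; yes; no; contradiction; ¬¬-excluded-middle; decidable-stable)
open import Relation.Nullary.Negation using (¬¬-map)
open import Relation.Unary using (Decidable)
open import Relation.Nullary.Construct.Add.Supremum using (_⁺; [_]; ⊤⁺)
open import Relation.Binary.Construct.Add.Supremum.NonStrict ℕ._≤_
  using (_≤⁺_; [_]; _≤⊤⁺; [≤]-injective; ≤⁺-dec; ≤⁺-isTotalOrder-≡)

ℕ∞ : Set
ℕ∞ = ℕ ⁺

ℕ∞-totalOrder : TotalOrder _ _ _
ℕ∞-totalOrder = record { isTotalOrder = ≤⁺-isTotalOrder-≡ ℕ.≤-isTotalOrder }

open TotalOrder ℕ∞-totalOrder using ()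
  renaming (refl to ≤⁺-refl; reflexive to ≤⁺-reflexive; trans to ≤⁺-trans; antisym to ≤⁺-antisym)
open import Data.List.Extrema ℕ∞-totalOrder using (argmin; argmax; f[argmin]≤v⁺; v≤f[argmax]⁺)

infixr 6 _+∞_
_+∞_ : ℕ → ℕ∞ → ℕ∞
m +∞ [ a ] = [ m + a ]
m +∞ ⊤⁺    = ⊤⁺

+∞-identityˡ : ∀ u → 0 +∞ u ≡ u
+∞-identityˡ [ a ] = refl
+∞-identityˡ ⊤⁺    = refl

+∞-assoc : ∀ m n u → m +∞ n +∞ u ≡ (m + n) +∞ u
+∞-assoc m n [ a ] = cong [_] (sym (ℕ.+-assoc m n a))
+∞-assoc m n ⊤⁺    = refl

+∞-monoʳ-≤⁺ : ∀ m {u w} → u ≤⁺ w → m +∞ u ≤⁺ m +∞ w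
+∞-monoʳ-≤⁺ m [ a≤b ] = [ ℕ.+-monoʳ-≤ m a≤b ]
+∞-monoʳ-≤⁺ m (u ≤⊤⁺) = (m +∞ u) ≤⊤⁺

u≤⁺[n]⇒u≡[] : ∀ {u n} → u ≤⁺ [ n ] → ∃[ c ] (u ≡ [ c ] × c ≤ n)
u≤⁺[n]⇒u≡[] [ c≤n ] = _ , refl , c≤n

m+∞u≤⁺[n]⇒u≡[] : ∀ m u {n} → m +∞ u ≤⁺ [ n ] → ∃[ c ] (u ≡ [ c ] × m + c ≤ n)
m+∞u≤⁺[n]⇒u≡[] m [ c ] [ le ] = c , refl , le

-- Pointwise decrease of a function into ℕ∞ is measured lexicographically by
-- the number of infinite values and the sum of the finite ones.

infix 4 _<ₗ_
_<ₗ_ : ℕ × ℕ → ℕ × ℕ → Set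
_<ₗ_ = ×-Lex _≡_ _<_ _<_

<ₗ-wellFounded : WellFounded _<ₗ_
<ₗ-wellFounded = ×-wellFounded <-wellFounded <-wellFounded

<ₗ-trans : ∀ {p q r} → p <ₗ q → q <ₗ r → p <ₗ r
<ₗ-trans = ×-transitive {_≈₁_ = _≡_} {_<₁_ = _<_} {_<₂_ = _<_} isEquivalence (resp₂ _<_) ℕ.<-trans ℕ.<-trans

infixl 6 _⊕_
_⊕_ : ℕ × ℕ → ℕ × ℕ → ℕ × ℕ
(a , b) ⊕ (c , d) = a + c , b + d

⊕-monoˡ-<ₗ : ∀ {p q} r → p <ₗ q → p ⊕ r <ₗ q ⊕ r
⊕-monoˡ-<ₗ (c , d) (inj₁ a<a')          = inj₁ (ℕ.+-monoˡ-< c a<a')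
⊕-monoˡ-<ₗ (c , d) (inj₂ (refl , b<b')) = inj₂ (refl , ℕ.+-monoˡ-< d b<b')

⊕-monoʳ-<ₗ : ∀ p {q r} → q <ₗ r → p ⊕ q <ₗ p ⊕ r
⊕-monoʳ-<ₗ (a , b) (inj₁ c<c')          = inj₁ (ℕ.+-monoʳ-< a c<c')
⊕-monoʳ-<ₗ (a , b) (inj₂ (refl , d<d')) = inj₂ (refl , ℕ.+-monoʳ-< b d<d')

height : ℕ∞ → ℕ × ℕ
height [ a ] = 0 , a
height ⊤⁺    = 1 , 0

height-≤⁺ : ∀ {u w} → u ≤⁺ w → u ≡ w ⊎ height u <ₗ height w
height-≤⁺ [ a≤b ] with ℕ.m≤n⇒m<n∨m≡n a≤b
... | inj₁ a<b  = inj₂ (inj₂ (refl , a<b))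
... | inj₂ refl = inj₁ refl
height-≤⁺ ([ a ] ≤⊤⁺) = inj₂ (inj₁ (s≤s z≤n))
height-≤⁺ (⊤⁺ ≤⊤⁺)    = inj₁ refl

module _ {X : Set} where

  weight : (X → ℕ∞) → List X → ℕ × ℕ
  weight d []       = 0 , 0
  weight d (x ∷ xs) = height (d x) ⊕ weight d xs

  weight-cong : ∀ {d' d} {xs} → All (λ x → d' x ≡ d x) xs → weight d' xs ≡ weight d xs
  weight-cong []         = refl
  weight-cong (eq ∷ eqs) = cong₂ (λ u w → height u ⊕ w) eq (weight-cong eqs)

  weight-antitone : ∀ {d' d} xs → All (λ x → d' x ≤⁺ d x) xs →
                    All (λ x → d' x ≡ d x) xs ⊎ weight d' xs <ₗ weight d xs
  weight-antitone []       []         = inj₁ []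
  weight-antitone {d'} {d} (x ∷ xs) (le ∷ les) with height-≤⁺ le | weight-antitone xs les
  ... | inj₁ eq | inj₁ eqs = inj₁ (eq ∷ eqs)
  ... | inj₁ eq | inj₂ lt  rewrite eq = inj₂ (⊕-monoʳ-<ₗ (height (d x)) lt)
  ... | inj₂ lt | inj₁ eqs rewrite weight-cong eqs = inj₂ (⊕-monoˡ-<ₗ (weight d xs) lt)
  ... | inj₂ lt | inj₂ lt' = inj₂ (<ₗ-trans (⊕-monoˡ-<ₗ (weight d' xs) lt) (⊕-monoʳ-<ₗ (height (d x)) lt'))

  antitone-stabilises : (xs : List X) → (∀ x → x ∈ xs) →
                        (d : ℕ → X → ℕ∞) → (∀ j x → d (suc j) x ≤⁺ d j x) →
                        ∃[ J ] (∀ x → d (suc J) x ≡ d J x)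
  antitone-stabilises xs enum d d-antitone = go 0 (<ₗ-wellFounded _)
    where
    go : ∀ j → Acc _<ₗ_ (weight (d j) xs) → ∃[ J ] (∀ x → d (suc J) x ≡ d J x)
    go j (acc rec) with weight-antitone xs (All.tabulate λ {x} _ → d-antitone j x)
    ... | inj₁ eqs = j , λ x → All.lookup eqs (enum x)
    ... | inj₂ lt  = go (suc j) (rec lt)

prefixSum : (ℕ → ℕ) → ℕ → ℕ
prefixSum c zero    = 0
prefixSum c (suc i) = prefixSum c i + c i

potential-telescope : ∀ {X : Set} (Φ : X → ℕ∞) (x : ℕ → X) (c : ℕ → ℕ) →
                      (∀ i → Φ (x i) ≤⁺ c i +∞ Φ (x (suc i))) →
                      ∀ m → Φ (x 0) ≤⁺ prefixSum c m +∞ Φ (x m)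
potential-telescope Φ x c step zero    = ≤⁺-reflexive (sym (+∞-identityˡ (Φ (x 0))))
potential-telescope Φ x c step (suc m) =
  ≤⁺-trans (potential-telescope Φ x c step m)
    (≤⁺-trans (+∞-monoʳ-≤⁺ (prefixSum c m) (step m)) (≤⁺-reflexive (+∞-assoc (prefixSum c m) (c m) _)))

least-witness : ∀ {P : ℕ → Set} → Decidable P → ∀ m → P m → ∃[ r ] (P r × (∀ j → P j → r ≤ j))
least-witness P? zero p = 0 , p , λ _ _ → z≤n
least-witness P? (suc m) p with P? 0
... | yes p₀ = 0 , p₀ , λ _ _ → z≤n
... | no ¬p₀ with least-witness (P? ∘ suc) m p
...   | r , pr , r-least = suc r , pr , λ where
          zero    p₀ → contradiction p₀ ¬p₀
          (suc j) pj → s≤s (r-least j pj)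


-- Definitionally equal to MaskingGame.IsLimit, which depends on the game only nominally.
infix 4 _⟶_
_⟶_ : (ℕ → ℚ) → ℚ → Set
u ⟶ q = ∀ ε → 0ℚ ℚ.< ε → ∃[ N ] (∀ m → N ≤ m → ℚ.∣ u m ℚ.- q ∣ ℚ.< ε)

p≤∣p∣ : ∀ p → p ℚ.≤ ℚ.∣ p ∣
p≤∣p∣ (mkℚ -[1+ _ ] _ _) = ℚ.*≤* ℤ.-≤+
p≤∣p∣ (mkℚ (+ _)    _ _) = ℚ.≤-refl

-p≤∣p∣ : ∀ p → ℚ.- p ℚ.≤ ℚ.∣ p ∣
-p≤∣p∣ p = subst (ℚ.- p ℚ.≤_) (ℚ.∣-p∣≡∣p∣ p) (p≤∣p∣ (ℚ.- p))

p<q⇒0<q-p : ∀ {p q} → p ℚ.< q → 0ℚ ℚ.< q ℚ.- p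
p<q⇒0<q-p {p} {q} p<q = subst (ℚ._< q ℚ.- p) (ℚ.+-inverseʳ p) (ℚ.+-monoˡ-< (ℚ.- p) p<q)

eventually-constant⇒⟶ : ∀ {u c} N → (∀ m → N ≤ m → u m ≡ c) → u ⟶ c
eventually-constant⇒⟶ {u} {c} N u≡c ε ε>0 = N , λ m N≤m →
  subst (λ z → ℚ.∣ z ℚ.- c ∣ ℚ.< ε) (sym (u≡c m N≤m))
        (subst (λ z → ℚ.∣ z ∣ ℚ.< ε) (sym (ℚ.+-inverseʳ c)) ε>0)

⟶-upper-bound : ∀ {u q c} N → u ⟶ q → (∀ m → N ≤ m → u m ℚ.≤ c) → q ℚ.≤ c
⟶-upper-bound {u} {q} {c} N u⟶q u≤c with q ℚ.≤? c
... | yes q≤c = q≤c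
... | no  q≰c = contradiction (ℚ.≤-<-trans q-c≤q-um q-um<q-c) (ℚ.<-irrefl refl)
  where
  close = u⟶q (q ℚ.- c) (p<q⇒0<q-p (ℚ.≰⇒> q≰c))
  m     = N ℕ.⊔ proj₁ close
  q-c≤q-um : q ℚ.- c ℚ.≤ q ℚ.- u m
  q-c≤q-um = ℚ.+-monoʳ-≤ q (ℚ.neg-antimono-≤ (u≤c m (ℕ.m≤m⊔n N _)))
  q-um<q-c : q ℚ.- u m ℚ.< q ℚ.- c
  q-um<q-c = ℚ.≤-<-trans (subst (ℚ._≤ ℚ.∣ u m ℚ.- q ∣) (⁻¹-anti-homo‿- (u m) q) (-p≤∣p∣ (u m ℚ.- q)))
                         (proj₂ close m (ℕ.m≤n⊔m N _))

⟶-lower-bound : ∀ {u q c} N → u ⟶ q → (∀ m → N ≤ m → c ℚ.≤ u m) → c ℚ.≤ q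
⟶-lower-bound {u} {q} {c} N u⟶q c≤u with c ℚ.≤? q
... | yes c≤q = c≤q
... | no  c≰q = contradiction (ℚ.≤-<-trans c-q≤um-q um-q<c-q) (ℚ.<-irrefl refl)
  where
  close = u⟶q (c ℚ.- q) (p<q⇒0<q-p (ℚ.≰⇒> c≰q))
  m     = N ℕ.⊔ proj₁ close
  c-q≤um-q : c ℚ.- q ℚ.≤ u m ℚ.- q
  c-q≤um-q = ℚ.+-monoˡ-≤ (ℚ.- q) (c≤u m (ℕ.m≤m⊔n N _))
  um-q<c-q : u m ℚ.- q ℚ.< c ℚ.- q
  um-q<c-q = ℚ.≤-<-trans (p≤∣p∣ (u m ℚ.- q)) (proj₂ close m (ℕ.m≤n⊔m N _))

-- Opaque because unification would otherwise unfold the gcd normalisation of _/_.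
opaque
  1/[1+_] : ℕ → ℚ
  1/[1+ s ] = + 1 / suc s

  1/[1+]-unfold : ∀ s → 1/[1+ s ] ≡ + 1 / suc s
  1/[1+]-unfold s = refl

  1/[1+]-antitone : ∀ {d s} → d ≤ s → 1/[1+ s ] ℚ.≤ 1/[1+ d ]
  1/[1+]-antitone {d} {s} d≤s = ℚ.toℚᵘ-cancel-≤
    (ℚᵘ.≤-respˡ-≃ (ℚᵘ.≃-sym (ℚ.toℚᵘ-fromℚᵘ (mkℚᵘ (+ 1) s)))
      (ℚᵘ.≤-respʳ-≃ (ℚᵘ.≃-sym (ℚ.toℚᵘ-fromℚᵘ (mkℚᵘ (+ 1) d)))
        (ℚᵘ.*≤* (subst₂ ℤ._≤_ (sym (ℤ.*-identityˡ _)) (sym (ℤ.*-identityˡ _)) (ℤ.+≤+ (s≤s d≤s))))))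

  0≤1/[1+_] : ∀ s → 0ℚ ℚ.≤ 1/[1+ s ]
  0≤1/[1+ s ] = ℚ.nonNegative⁻¹ _ {{ℚ.normalize-nonNeg 1 (suc s)}}

module _ {A B : Set} where

  ∈-concatMap-at : ∀ {g : A → List B} {x xs y} → x ∈ xs → y ∈ g x → y ∈ concatMap g xs
  ∈-concatMap-at {g} x∈xs y∈gx = ∈-concatMap⁺ g (lose x∈xs y∈gx)

module _ {B : Set} where

  whenTrue : (b : Bool) → (b ≡ true → B) → List B
  whenTrue true  g = g refl ∷ []
  whenTrue false g = []

  ∈-whenTrue : ∀ {b} (g : b ≡ true → B) (p : b ≡ true) → g p ∈ whenTrue b g
  ∈-whenTrue g refl = here refl

-- Opaque so that mk can be inferred from trueAt b mk by unification.
opaque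
  trueAt : ∀ {B : Set} {m} (b : Fin m → Bool) → (∀ t → b t ≡ true → B) → List B
  trueAt b mk = concatMap (λ t → whenTrue (b t) (mk t)) (allFin _)

  ∈-trueAt : ∀ {B : Set} {m} {b : Fin m → Bool} (mk : ∀ t → b t ≡ true → B) {t} (p : b t ≡ true) →
             mk t p ∈ trueAt b mk
  ∈-trueAt mk {t} p = ∈-concatMap-at (∈-allFin t) (∈-whenTrue (mk t) p)

module Game {n n' k f : ℕ} (A : TS (Fin n) (Fin k)) (A' : TS (Fin n') (Fin k ⊎ Fin f)) where
  open MaskingGame A A' renaming (sym to symbol)

  allLabels : List (Fin k ⊎ Fin f)
  allLabels = map inj₁ (allFin k) ++ map inj₂ (allFin f)

  ∈-allLabels : ∀ l → l ∈ allLabels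
  ∈-allLabels (inj₁ σ) = ∈-++⁺ˡ (∈-map⁺ inj₁ (∈-allFin σ))
  ∈-allLabels (inj₂ F) = ∈-++⁺ʳ _ (∈-map⁺ inj₂ (∈-allFin F))

  nodesAt : Fin n → Fin n' → List Node
  nodesAt s s' = rN s s' ∷ map (λ σ → v1N s σ s') (allFin k) ++ map (λ l → v2N s l s') allLabels

  allNodes : List Node
  allNodes = err ∷ concatMap (λ s → concatMap (nodesAt s) (allFin n')) (allFin n)

  ∈-allNodes : ∀ x → x ∈ allNodes
  ∈-allNodes err          = here refl
  ∈-allNodes (rN s s')    = there (∈-concatMap-at (∈-allFin s) (∈-concatMap-at (∈-allFin s') (here refl)))
  ∈-allNodes (v1N s σ s') = there (∈-concatMap-at (∈-allFin s) (∈-concatMap-at (∈-allFin s')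
                              (there (∈-++⁺ˡ (∈-map⁺ _ (∈-allFin σ))))))
  ∈-allNodes (v2N s l s') = there (∈-concatMap-at (∈-allFin s) (∈-concatMap-at (∈-allFin s')
                              (there (∈-++⁺ʳ _ (∈-map⁺ _ (∈-allLabels l))))))

  successors : (x : Node) → List (Move x)
  successors (rN s s') =
       concatMap (λ σ → trueAt (TS.E A s σ) (λ t p → symbol σ , v1N t σ s' , std (rA p))) (allFin k)
    ++ concatMap (λ l → trueAt (TS.E A' s' l) (λ t' p → lab l , v2N s l t' , std (rA' p))) allLabels
  successors (v1N s σ s')        = trueAt (TS.E A' s' (inj₁ σ)) (λ t' p → symbol σ , rN s t' , std (vA' p))
  successors (v2N s (inj₁ σ) s') = trueAt (TS.E A s σ) (λ t p → symbol σ , rN t s' , std (vA p))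
  successors (v2N s (inj₂ F) s') = trueAt (TS.E (A ᴹ) s (inj₂ tt)) (λ t p → M , rN t s' , std (vM p))
  successors err                 = []

  successors-complete : ∀ {x e y} (p : StdEdge x e y) → (e , y , std p) ∈ successors x
  successors-complete (rA {σ = σ} p)  = ∈-++⁺ˡ (∈-concatMap-at (∈-allFin σ) (∈-trueAt _ p))
  successors-complete (rA' {l = l} p) = ∈-++⁺ʳ _ (∈-concatMap-at (∈-allLabels l) (∈-trueAt _ p))
  successors-complete (vA p)          = ∈-trueAt _ p
  successors-complete (vA' p)         = ∈-trueAt _ p
  successors-complete (vM p)          = ∈-trueAt _ p

  -- The edge to s_err is not among the successors; it is the default move
  -- exactly when there are none.
  defaultMove : (x : Node) → Move x
  defaultMove x with successors x | successors-complete {x}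
  ... | m ∷ _ | _        = m
  ... | []    | complete = τ , err , toErr λ e y p → case complete p of λ ()

  HasEnds : ∀ {x} → GLabel → Node → Move x → Set
  HasEnds e y (e′ , y′ , _) = e′ ≡ e × y′ ≡ y

  defaultMove-toErr : ∀ x → (∀ e y → ¬ StdEdge x e y) → HasEnds τ err (defaultMove x)
  defaultMove-toErr x noStd with successors x | successors-complete {x}
  ... | (e , y , std p) ∷ _ | _ = ⊥-elim (noStd e y p)
  ... | (_ , _ , toErr _) ∷ _ | _ = refl , refl
  ... | []                    | _ = refl , refl

  candidates-cover : ∀ {x e y} → Edge x e y →
                     HasEnds e y (defaultMove x) ⊎ Any (HasEnds e y) (successors x)
  candidates-cover     (std p)       = inj₂ (lose (successors-complete p) (refl , refl))
  candidates-cover {x} (toErr noStd) = inj₁ (defaultMove-toErr x noStd)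

  cost : (Node → ℕ∞) → ∀ {x} → Move x → ℕ∞
  cost d (e , y , _) = χF e +∞ d y

  cost-HasEnds : ∀ d {x e y} (m : Move x) → HasEnds e y m → cost d m ≡ χF e +∞ d y
  cost-HasEnds d m (refl , refl) = refl

  best : Player → (Node → ℕ∞) → (x : Node) → Move x
  best R d x = argmin (cost d) (defaultMove x) (successors x)
  best V d x = argmax (cost d) (defaultMove x) (successors x)

  best-R-≤ : ∀ d {x e y} → Edge x e y → cost d (best R d x) ≤⁺ χF e +∞ d y
  best-R-≤ d {x} {e} {y} p =
    f[argmin]≤v⁺ (defaultMove x) (successors x)
      (Sum.map (at≤ {defaultMove x}) (Any.map λ {m} → at≤ {m}) (candidates-cover p))
    where
    at≤ : ∀ {m : Move x} → HasEnds e y m → cost d m ≤⁺ χF e +∞ d y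
    at≤ {m} ends = ≤⁺-reflexive (cost-HasEnds d m ends)

  best-V-≥ : ∀ d {x e y} → Edge x e y → χF e +∞ d y ≤⁺ cost d (best V d x)
  best-V-≥ d {x} {e} {y} p =
    v≤f[argmax]⁺ (defaultMove x) (successors x)
      (Sum.map (≤at {defaultMove x}) (Any.map λ {m} → ≤at {m}) (candidates-cover p))
    where
    ≤at : ∀ {m : Move x} → HasEnds e y m → χF e +∞ d y ≤⁺ cost d m
    ≤at {m} ends = ≤⁺-reflexive (sym (cost-HasEnds d m ends))

  cost-monotone : ∀ {d d'} → (∀ x → d x ≤⁺ d' x) → ∀ {x} (m : Move x) → cost d m ≤⁺ cost d' m
  cost-monotone d≤d' (e , y , _) = +∞-monoʳ-≤⁺ (χF e) (d≤d' y)

  bellman : (Node → ℕ∞) → Node → ℕ∞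
  bellman d x = cost d (best (owner x) d x)

  bellman-monotone : ∀ {d d'} → (∀ x → d x ≤⁺ d' x) → ∀ x → bellman d x ≤⁺ bellman d' x
  bellman-monotone {d} {d'} d≤d' x with owner x
  ... | R = ≤⁺-trans (best-R-≤ d (proj₂ (proj₂ (best R d' x)))) (cost-monotone d≤d' (best R d' x))
  ... | V = ≤⁺-trans (cost-monotone d≤d' (best V d x)) (best-V-≥ d' (proj₂ (proj₂ (best V d x))))

  owner-cases : ∀ x → owner x ≡ R ⊎ owner x ≡ V
  owner-cases (rN _ _)    = inj₁ refl
  owner-cases (v1N _ _ _) = inj₂ refl
  owner-cases (v2N _ _ _) = inj₂ refl
  owner-cases err         = inj₁ refl

  bellman-owner : ∀ d x {P} → owner x ≡ P → bellman d x ≡ cost d (best P d x)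
  bellman-owner d x refl = refl

  bellman-err : ∀ d → bellman d err ≡ d err
  bellman-err d = +∞-identityˡ (d err)

  -- costWithin j x: the fewest faults with which R can force the play from x
  -- into s_err within j moves.
  costWithin : ℕ → Node → ℕ∞
  costWithin zero    err = [ 0 ]
  costWithin zero    _   = ⊤⁺
  costWithin (suc j)     = bellman (costWithin j)

  costWithin-err : ∀ j → costWithin j err ≡ [ 0 ]
  costWithin-err zero    = refl
  costWithin-err (suc j) = trans (bellman-err (costWithin j)) (costWithin-err j)

  costWithin-suc-≤ : ∀ j x → costWithin (suc j) x ≤⁺ costWithin j x
  costWithin-suc-≤ zero    err          = ≤⁺-reflexive (costWithin-err 1)
  costWithin-suc-≤ zero    (rN _ _)     = _ ≤⊤⁺
  costWithin-suc-≤ zero    (v1N _ _ _)  = _ ≤⊤⁺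
  costWithin-suc-≤ zero    (v2N _ _ _)  = _ ≤⊤⁺
  costWithin-suc-≤ (suc j)              = bellman-monotone (costWithin-suc-≤ j)

  costWithin-antitone : ∀ {i j} → i ≤′ j → ∀ x → costWithin j x ≤⁺ costWithin i x
  costWithin-antitone ≤′-refl             x = ≤⁺-refl
  costWithin-antitone (≤′-step {j} i≤j) x = ≤⁺-trans (costWithin-suc-≤ j x) (costWithin-antitone i≤j x)

  opaque
    stabilisation : ∃[ J ] (∀ x → costWithin (suc J) x ≡ costWithin J x)
    stabilisation = antitone-stabilises allNodes ∈-allNodes costWithin costWithin-suc-≤

  J : ℕ
  J = proj₁ stabilisation

  forcingCost : Node → ℕ∞
  forcingCost = costWithin J

  forcingCost-fixed : ∀ x → bellman forcingCost x ≡ forcingCost x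
  forcingCost-fixed = proj₂ stabilisation

  forcingCost-≤ : ∀ {j} → j ≤ J → ∀ x → forcingCost x ≤⁺ costWithin j x
  forcingCost-≤ j≤J = costWithin-antitone (ℕ.≤⇒≤′ j≤J)

  forcingCost-err : forcingCost err ≡ [ 0 ]
  forcingCost-err = costWithin-err J

  -- The first round of value iteration at which the cost of x is settled.
  rank-witness : ∀ x → ∃[ r ] (costWithin r x ≤⁺ forcingCost x × (∀ j → costWithin j x ≤⁺ forcingCost x → r ≤ j))
  rank-witness x = least-witness (λ j → ≤⁺-dec ℕ._≤?_ (costWithin j x) (forcingCost x)) J ≤⁺-refl

  rank : Node → ℕ
  rank x = proj₁ (rank-witness x)

  rank-≤ : ∀ x → rank x ≤ J
  rank-≤ x = proj₂ (proj₂ (rank-witness x)) J ≤⁺-refl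

  rank-minimal : ∀ {x j} → costWithin j x ≡ forcingCost x → rank x ≤ j
  rank-minimal {x} {j} eq = proj₂ (proj₂ (rank-witness x)) j (≤⁺-reflexive eq)

  costWithin-rank : ∀ x → costWithin (rank x) x ≡ forcingCost x
  costWithin-rank x = ≤⁺-antisym (proj₁ (proj₂ (rank-witness x))) (forcingCost-≤ (rank-≤ x) x)

  rank-suc : ∀ {x a} → x ≢ err → forcingCost x ≡ [ a ] → ∃[ r ] (rank x ≡ suc r)
  rank-suc {x} x≢err eq with rank x | costWithin-rank x
  ... | suc r | _ = r , refl
  ... | zero  | settled with x
  ...   | err         = contradiction refl x≢err
  ...   | rN _ _      = case trans settled eq of λ ()
  ...   | v1N _ _ _   = case trans settled eq of λ ()
  ...   | v2N _ _ _   = case trans settled eq of λ ()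

  positional : ∀ {P} → ((x : Node) → Move x) → Strategy P
  positional σ _ x _ = σ x

  positional-memoryless : ∀ {P} (σ : (x : Node) → Move x) → Memoryless {P} (positional σ)
  positional-memoryless σ _ _ _ _ = refl

  move-positional-R : ∀ σ πV past x → owner x ≡ R → move (positional σ) πV past x ≡ σ x
  move-positional-R σ πV past (rN _ _) _ = refl
  move-positional-R σ πV past err      _ = refl

  move-positional-V : ∀ πR σ past x → owner x ≡ V → move πR (positional σ) past x ≡ σ x
  move-positional-V πR σ past (v1N _ _ _) _ = refl
  move-positional-V πR σ past (v2N _ _ _) _ = refl

  edge-from-err : ∀ {e y} → Edge err e y → e ≡ τ × y ≡ err
  edge-from-err (std ())
  edge-from-err (toErr _) = refl , refl

  _≟err : ∀ x → Dec (x ≡ err)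
  rN _ _    ≟err = no λ ()
  v1N _ _ _ ≟err = no λ ()
  v2N _ _ _ ≟err = no λ ()
  err       ≟err = yes refl

  χerr-≢err : ∀ {y} → y ≢ err → χerr y ≡ 0
  χerr-≢err {rN _ _}    _ = refl
  χerr-≢err {v1N _ _ _} _ = refl
  χerr-≢err {v2N _ _ _} _ = refl
  χerr-≢err {err}  y≢err = contradiction refl y≢err

  module Play (πR : Strategy R) (πV : Strategy V) where

    node : ℕ → Node
    node i = proj₂ (cfg πR πV i)

    moveAt : (i : ℕ) → Move (node i)
    moveAt i = move πR πV (proj₁ (cfg πR πV i)) (node i)

    label : ℕ → GLabel
    label = edgeLabel πR πV

    step : ∀ i → Edge (node i) (label i) (node (suc i))
    step i = proj₂ (proj₂ (moveAt i))

    faults : ℕ → ℕ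
    faults = prefixSum (χF ∘ label)

    sumUpTo-faults : ∀ m → sumUpTo (χF ∘ label) m ≡ faults (suc m)
    sumUpTo-faults zero    = refl
    sumUpTo-faults (suc m) = cong (_+ χF (label (suc m))) (sumUpTo-faults m)

    ratio-≡ : ∀ m → ratio πR πV m ≡ + χerr (node (suc m)) / suc (faults (suc m))
    ratio-≡ m = cong (λ s → + χerr (node (suc m)) / suc s) (sumUpTo-faults m)

    err-absorbing : ∀ {K i} → node K ≡ err → K ≤′ i → node i ≡ err × faults i ≡ faults K
    err-absorbing at-err ≤′-refl = at-err , refl
    err-absorbing {K} at-err (≤′-step {i} K≤i) with err-absorbing at-err K≤i
    ... | still-err , same-faults
        with edge-from-err (subst (λ x → Edge x (label i) (node (suc i))) still-err (step i))
    ...   | τ-edge , next-err = next-err , trans (cong₂ _+_ same-faults (cong χF τ-edge)) (ℕ.+-identityʳ _)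

    ratio-at-err : ∀ m → node (suc m) ≡ err → ratio πR πV m ≡ 1/[1+ faults (suc m) ]
    ratio-at-err m at-err = trans (ratio-≡ m)
      (trans (cong (λ x → + χerr x / suc (faults (suc m))) at-err) (sym (1/[1+]-unfold (faults (suc m)))))

    ratio-after-err : ∀ {K} → node K ≡ err → ∀ m → K ≤ m → ratio πR πV m ≡ 1/[1+ faults K ]
    ratio-after-err at-err m K≤m with err-absorbing at-err (ℕ.≤⇒≤′ (ℕ.m≤n⇒m≤1+n K≤m))
    ... | later-err , same-faults = trans (ratio-at-err m later-err) (cong 1/[1+_] same-faults)

    ratio-≢err : ∀ m → node (suc m) ≢ err → ratio πR πV m ≡ 0ℚ
    ratio-≢err m not-err = begin
      ratio πR πV m                                   ≡⟨ ratio-≡ m ⟩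
      + χerr (node (suc m)) / suc (faults (suc m))    ≡⟨ cong (λ c → + c / suc (faults (suc m))) (χerr-≢err not-err) ⟩
      + 0 / suc (faults (suc m))                      ≡⟨ ℚ.0/n≡0 (suc (faults (suc m))) ⟩
      0ℚ                                              ∎
      where open ≡-Reasoning

    0≤ratio : ∀ m → 0ℚ ℚ.≤ ratio πR πV m
    0≤ratio m with node (suc m) ≟err
    ... | yes at-err  = subst (0ℚ ℚ.≤_) (sym (ratio-at-err m at-err)) (0≤1/[1+ faults (suc m) ])
    ... | no  not-err = ℚ.≤-reflexive (sym (ratio-≢err m not-err))

    -- Whether the play ever reaches s_err is not decidable, so the limit is
    -- only shown to exist up to double negation.
    limit-exists : ¬ ¬ (∃[ q ] fmIs πR πV q)
    limit-exists no-limit = ¬¬-excluded-middle {A = ∃[ K ] node K ≡ err} λ where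
      (yes (K , at-err)) → no-limit (1/[1+ faults K ] , eventually-constant⇒⟶ K (ratio-after-err at-err))
      (no never-err)     → no-limit (0ℚ , eventually-constant⇒⟶ 0 λ m _ → ratio-≢err m λ e → never-err (suc m , e))

  Progress : Node → ℕ → ℕ → Node → Set
  Progress x a c y = ∃[ b ] (forcingCost y ≡ [ b ] × c + b ≤ a × (b , rank y) <ₗ (a , rank x))

  -- An edge no worse than the round that settled x either lowers the forcing
  -- cost or leads to a node settled in an earlier round.
  progress : ∀ {x a r e y} → forcingCost x ≡ [ a ] → rank x ≡ suc r →
             χF e +∞ costWithin r y ≤⁺ costWithin (suc r) x → Progress x a (χF e) y
  progress {x} {a} {r} {e} {y} cost-x rank-x bound with m+∞u≤⁺[n]⇒u≡[] (χF e) (costWithin r y) bound′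
    where
    bound′ : χF e +∞ costWithin r y ≤⁺ [ a ]
    bound′ = subst (χF e +∞ costWithin r y ≤⁺_)
                   (trans (subst (λ j → costWithin j x ≡ forcingCost x) rank-x (costWithin-rank x)) cost-x) bound
  ... | c , within-r , χ+c≤a with u≤⁺[n]⇒u≡[] (subst (forcingCost y ≤⁺_) within-r (forcingCost-≤ r≤J y))
    where
    r≤J : r ≤ J
    r≤J = ℕ.<⇒≤ (subst (_≤ J) rank-x (rank-≤ x))
  ... | b , cost-y , b≤c = b , cost-y , χ+b≤a , lex (ℕ.m≤n⇒m<n∨m≡n b≤a)
    where
    χ+b≤a = ℕ.≤-trans (ℕ.+-monoʳ-≤ (χF e) b≤c) χ+c≤a
    b≤a = ℕ.≤-trans (ℕ.m≤n+m b (χF e)) χ+b≤a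
    lex : b < a ⊎ b ≡ a → (b , rank y) <ₗ (a , rank x)
    lex (inj₁ b<a) = inj₁ b<a
    lex (inj₂ b≡a) = inj₂ (b≡a , subst (rank y <_) (sym rank-x) (s≤s (rank-minimal settled-y)))
      where
      c≡b : c ≡ b
      c≡b = ℕ.≤-antisym (subst (c ≤_) (sym b≡a) (ℕ.≤-trans (ℕ.m≤n+m c (χF e)) χ+c≤a)) b≤c
      settled-y : costWithin r y ≡ forcingCost y
      settled-y = trans within-r (trans (cong [_] c≡b) (sym cost-y))

  progress-reaches-err : (x : ℕ → Node) (c : ℕ → ℕ) →
                         (∀ i {a} → x i ≢ err → forcingCost (x i) ≡ [ a ] → Progress (x i) a (c i) (x (suc i))) →
                         ∀ {a} → forcingCost (x 0) ≡ [ a ] → ∃[ K ] (x K ≡ err × prefixSum c K ≤ a)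
  progress-reaches-err x c progress-at {a} cost-0 = go 0 a (<ₗ-wellFounded _) cost-0
    where
    go : ∀ i a → Acc _<ₗ_ (a , rank (x i)) → forcingCost (x i) ≡ [ a ] →
         ∃[ K ] (x K ≡ err × prefixSum c K ≤ prefixSum c i + a)
    go i a (acc rec) cost-i with x i ≟err
    ... | yes at-err = i , at-err , ℕ.m≤m+n (prefixSum c i) a
    ... | no not-err with progress-at i not-err cost-i
    ...   | b , cost-next , c+b≤a , lex with go (suc i) b (rec lex) cost-next
    ...     | K , at-err , sum-K = K , at-err , ℕ.≤-trans sum-K (begin
      prefixSum c i + c i + b    ≡⟨ ℕ.+-assoc (prefixSum c i) (c i) b ⟩
      prefixSum c i + (c i + b)  ≤⟨ ℕ.+-monoʳ-≤ (prefixSum c i) c+b≤a ⟩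
      prefixSum c i + a          ∎)
      where open ℕ.≤-Reasoning

  refuterMove : (x : Node) → Move x
  refuterMove x = best R (costWithin (ℕ.pred (rank x))) x

  verifierMove : (x : Node) → Move x
  verifierMove = best V forcingCost

  πR* : Strategy R
  πR* = positional refuterMove

  πV* : Strategy V
  πV* = positional verifierMove

  value : ℕ∞ → ℚ
  value [ a ] = 1/[1+ a ]
  value ⊤⁺    = 0ℚ

  0≤value : ∀ u → 0ℚ ℚ.≤ value u
  0≤value [ a ] = 0≤1/[1+ a ]
  0≤value ⊤⁺    = ℚ.≤-refl

  value-≥ : ∀ {u s} → u ≤⁺ [ s ] → 1/[1+ s ] ℚ.≤ value u
  value-≥ [ a≤s ] = 1/[1+]-antitone a≤s

  v* : ℚ
  v* = value (forcingCost initNode)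

  module RefuterPlay (πV : Strategy V) where
    open Play πR* πV

    step-bound : ∀ i {r} → rank (node i) ≡ suc r →
                 χF (label i) +∞ costWithin r (node (suc i)) ≤⁺ costWithin (suc r) (node i)
    step-bound i {r} rank-x = Sum.[ at-R , at-V ]′ (owner-cases (node i))
      where
      at-R : owner (node i) ≡ R →
             χF (label i) +∞ costWithin r (node (suc i)) ≤⁺ costWithin (suc r) (node i)
      at-R own = ≤⁺-reflexive (begin
        cost (costWithin r) (moveAt i)
          ≡⟨ cong (cost (costWithin r)) (move-positional-R refuterMove πV _ (node i) own) ⟩
        cost (costWithin r) (refuterMove (node i))
          ≡⟨ cong (λ j → cost (costWithin r) (best R (costWithin (ℕ.pred j)) (node i))) rank-x ⟩
        cost (costWithin r) (best R (costWithin r) (node i))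
          ≡⟨ bellman-owner (costWithin r) (node i) own ⟨
        costWithin (suc r) (node i)                           ∎)
        where open ≡-Reasoning
      at-V : owner (node i) ≡ V →
             χF (label i) +∞ costWithin r (node (suc i)) ≤⁺ costWithin (suc r) (node i)
      at-V own = ≤⁺-trans (best-V-≥ (costWithin r) (step i))
                          (≤⁺-reflexive (sym (bellman-owner (costWithin r) (node i) own)))

    forces-err : ∀ {a} → forcingCost initNode ≡ [ a ] → ∃[ K ] (node K ≡ err × faults K ≤ a)
    forces-err = progress-reaches-err node (χF ∘ label) λ i not-err cost-i →
      let r , rank-i = rank-suc not-err cost-i in progress cost-i rank-i (step-bound i rank-i)

    ratio-eventually-≥ : ∀ {a} → forcingCost initNode ≡ [ a ] →
                         ∃[ K ] (∀ m → K ≤ m → 1/[1+ a ] ℚ.≤ ratio πR* πV m)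
    ratio-eventually-≥ {a} cost-init = K , λ m K≤m →
      subst (1/[1+ a ] ℚ.≤_) (sym (ratio-after-err at-err m K≤m)) (1/[1+]-antitone faults-K)
      where
      reach = forces-err cost-init
      K = proj₁ reach
      at-err = proj₁ (proj₂ reach)
      faults-K = proj₂ (proj₂ reach)

  module VerifierPlay (πR : Strategy R) where
    open Play πR πV*

    step-bound : ∀ i → forcingCost (node i) ≤⁺ χF (label i) +∞ forcingCost (node (suc i))
    step-bound i = Sum.[ at-R , at-V ]′ (owner-cases (node i))
      where
      at-R : owner (node i) ≡ R → forcingCost (node i) ≤⁺ χF (label i) +∞ forcingCost (node (suc i))
      at-R own = ≤⁺-trans
        (≤⁺-reflexive (trans (sym (forcingCost-fixed (node i))) (bellman-owner forcingCost (node i) own)))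
        (best-R-≤ forcingCost (step i))
      at-V : owner (node i) ≡ V → forcingCost (node i) ≤⁺ χF (label i) +∞ forcingCost (node (suc i))
      at-V own = ≤⁺-reflexive (begin
        forcingCost (node i)                       ≡⟨ forcingCost-fixed (node i) ⟨
        bellman forcingCost (node i)               ≡⟨ bellman-owner forcingCost (node i) own ⟩
        cost forcingCost (verifierMove (node i))   ≡⟨ cong (cost forcingCost) (move-positional-V πR verifierMove _ (node i) own) ⟨
        cost forcingCost (moveAt i)                ∎)
        where open ≡-Reasoning

    cost-bound : ∀ m → forcingCost initNode ≤⁺ faults m +∞ forcingCost (node m)
    cost-bound = potential-telescope forcingCost node (χF ∘ label) step-bound

    cost-bound-at-err : ∀ m → node m ≡ err → forcingCost initNode ≤⁺ [ faults m ]
    cost-bound-at-err m at-err = subst (forcingCost initNode ≤⁺_)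
      (trans (cong (λ x → faults m +∞ forcingCost x) at-err)
             (trans (cong (faults m +∞_) forcingCost-err) (cong [_] (ℕ.+-identityʳ (faults m)))))
      (cost-bound m)

    ratio≤v* : ∀ m → ratio πR πV* m ℚ.≤ v*
    ratio≤v* m = by-cases (node (suc m) ≟err)
      where
      by-cases : Dec (node (suc m) ≡ err) → ratio πR πV* m ℚ.≤ v*
      by-cases (yes at-err)  = subst (ℚ._≤ v*) (sym (ratio-at-err m at-err)) (value-≥ (cost-bound-at-err (suc m) at-err))
      by-cases (no  not-err) = subst (ℚ._≤ v*) (sym (ratio-≢err m not-err)) (0≤value (forcingCost initNode))

  refuter-guarantee : ∀ πV q → fmIs πR* πV q → v* ℚ.≤ q
  refuter-guarantee πV q lim = bound (forcingCost initNode) refl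
    where
    open Play πR* πV
    open RefuterPlay πV
    bound : ∀ u → forcingCost initNode ≡ u → value u ℚ.≤ q
    bound [ a ] cost-init = ⟶-lower-bound (proj₁ eventually) lim (proj₂ eventually)
      where eventually = ratio-eventually-≥ cost-init
    bound ⊤⁺    _         = ⟶-lower-bound 0 lim λ m _ → 0≤ratio m

  verifier-guarantee : ∀ πR q → fmIs πR πV* q → q ℚ.≤ v*
  verifier-guarantee πR q lim = ⟶-upper-bound 0 lim λ m _ → ratio≤v* m
    where open VerifierPlay πR

  optimal-play : fmIs πR* πV* v*
  optimal-play = limit (forcingCost initNode) refl
    where
    open Play πR* πV*
    open RefuterPlay πV*
    open VerifierPlay πR*
    limit : ∀ u → forcingCost initNode ≡ u → ratio πR* πV* ⟶ value u
    limit [ a ] cost-init = eventually-constant⇒⟶ K λ m K≤m →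
      trans (ratio-after-err at-err m K≤m) (cong 1/[1+_] (ℕ.≤-antisym faults-K a≤faults-K))
      where
      reach = forces-err cost-init
      K = proj₁ reach
      at-err = proj₁ (proj₂ reach)
      faults-K = proj₂ (proj₂ reach)
      a≤faults-K : a ≤ faults K
      a≤faults-K = [≤]-injective (subst (_≤⁺ [ faults K ]) cost-init (cost-bound-at-err K at-err))
    limit ⊤⁺ cost-init = eventually-constant⇒⟶ 0 λ m _ → ratio-≢err m λ at-err →
      case subst (_≤⁺ [ faults (suc m) ]) cost-init (cost-bound-at-err (suc m) at-err) of λ ()

  saddle-point : ∀ {πR πV v} → (∀ πV′ q → fmIs πR πV′ q → v ℚ.≤ q) → (∀ πR′ q → fmIs πR′ πV q → q ℚ.≤ v) →
                 fmIs πR πV v → IsVal v × InfOverV πR v × SupOverR πV v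
  saddle-point {πR} {πV} {v} lower upper outcome = (sup-inf , inf-sup) , inf-at-πR , sup-at-πV
    where
    inf-at-πR : InfOverV πR v
    inf-at-πR = (λ q (πV′ , lim) → lower πV′ q lim) , λ w below → below v (πV , outcome)
    sup-at-πV : SupOverR πV v
    sup-at-πV = (λ q (πR′ , lim) → upper πR′ q lim) , λ w above → above v (πR , outcome)
    sup-inf : IsSup (λ u → ∃[ πR′ ] InfOverV πR′ u) v
    sup-inf = (λ u (πR′ , inf) → decidable-stable (u ℚ.≤? v)
                (¬¬-map (λ (q , lim) → ℚ.≤-trans (proj₁ inf q (πV , lim)) (upper πR′ q lim)) (Play.limit-exists πR′ πV)))
            , λ w above → above v (πR , inf-at-πR)
    inf-sup : IsInf (λ u → ∃[ πV′ ] SupOverR πV′ u) v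
    inf-sup = (λ u (πV′ , sup) → decidable-stable (v ℚ.≤? u)
                (¬¬-map (λ (q , lim) → ℚ.≤-trans (lower πV′ q lim) (proj₁ sup q (πR , lim))) (Play.limit-exists πR πV′)))
            , λ w below → below v (πV , sup-at-πV)

theorem8 : ∀ {n n' k f : ℕ}
           (A : TS (Fin n) (Fin k)) (A' : TS (Fin n') (Fin k ⊎ Fin f)) →
           let open MaskingGame A A' in
           ∃[ πR ] ∃[ πV ] ∃[ v ]
             (Memoryless {R} πR × Memoryless {V} πV
              × IsVal v × InfOverV πR v × SupOverR πV v)
theorem8 A A' =
  πR* , πV* , v* , positional-memoryless refuterMove , positional-memoryless verifierMove ,
  saddle-point refuter-guarantee verifier-guarantee optimal-play
  where open Game A A'
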